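{- As predicates in $\mathsf{P}(\mathfrak{P}(\Sigma)\times\mathfrak{P}(\Sigma))$: $[\![\dot{\textstyle\bigwedge}\{(\dot{\textstyle\bigwedge}s')\mathbin{\dot\to}\xi: s'\in s^{\subseteq},\ \xi\in t\}]\!]_{(s,t)\in\mathfrak{P}(\Sigma)^2}=[\![\dot{\textstyle\bigwedge}\{(\dot{\textstyle\bigwedge}s)\mathbin{\dot\to}\xi:\xi\in t\}]\!]_{(s,t)\in\mathfrak{P}(\Sigma)^2}$, where $s^{\subseteq}=\{s'\subseteq\Sigma:s\subseteq s'\}$.
   Context: $\mathsf{P}:\mathbf{Set}^{\mathrm{op}}\to\mathbf{HA}$ is a $\mathbf{Set}$-based tripos: a functor into Heyting algebras such that (1) each $\mathsf{P}f:\mathsf{P}Y\to\mathsf{P}X$ ($f:X\to Y$) has a left adjoint $\exists f$ and right adjoint $\forall f$ among monotone maps $\mathsf{P}X\to\mathsf{P}Y$; (2) for every pullback square in $\mathbf{Set}$ with $f_1:X\to X_1,f_2:X\to X_2,g_1:X_1\to Y,g_2:X_2\to Y$, $\exists f_1\circ\mathsf{P}f_2=\mathsf{P}g_1\circ\exists g_2$ and $\forall f_1\circ\mathsf{P}f_2=\mathsf{P}g_1\circ\forall g_2$; (3) there is a set $\Sigma$ and $\mathrm{tr}_\Sigma\in\mathsf{P}\Sigma$ with $\sigma\mapsto\mathsf{P}\sigma(\mathrm{tr}_\Sigma)$, $\Sigma^X\to\mathsf{P}X$, surjective for every set $X$. Fix these; for $\sigma\in\Sigma^X$ write $[\![\sigma]\!]_X=[\![\sigma_x]\!]_{x\in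 X}:=\mathsf{P}\sigma(\mathrm{tr}_\Sigma)$. Let $\pi,\pi'$ be the projections $\Sigma\times\Sigma\to\Sigma$ and $\dot\to:\Sigma\times\Sigma\to\Sigma$ (infix) any map with $[\![\dot\to]\!]_{\Sigma\times\Sigma}=[\![\pi]\!]_{\Sigma\times\Sigma}\to[\![\pi']\!]_{\Sigma\times\Sigma}$. Let $E=\{(\xi,s)\in\Sigma\times\mathfrak{P}(\Sigma):\xi\in s\}$ with projections $e_1,e_2$, and $\dot\bigwedge:\mathfrak{P}(\Sigma)\to\Sigma$ any map with $[\![\dot\bigwedge]\!]_{\mathfrak{P}(\Sigma)}=\forall e_2([\![e_1]\!]_E)$. The axiom of choice is assumed. -}

module Defs where

open import Level using (Level; _⊔_; suc; zero; Setω)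
open import Data.Product using (Σ; _×_; _,_; proj₁; proj₂; ∃)
open import Relation.Binary.PropositionalEquality using (_≡_)
open import Relation.Binary.Lattice.Bundles using (HeytingAlgebra)
open import Function using (_∘_; id)

-- The base category Set is modelled by the universe hierarchy: objects are
-- types  X : Set a  (any level a), morphisms are functions.

record IsPullback {x x₁ x₂ y : Level} {X : Set x} {X₁ : Set x₁} {X₂ : Set x₂} {Y : Set y}
                  (f₁ : X → X₁) (f₂ : X → X₂) (g₁ : X₁ → Y) (g₂ : X₂ → Y)
                  : Set (x ⊔ x₁ ⊔ x₂ ⊔ y) where
  field
    commutes  : ∀ u → g₁ (f₁ u) ≡ g₂ (f₂ u)
    gap       : ∀ u₁ u₂ → g₁ u₁ ≡ g₂ u₂ → X
    gap-f₁    : ∀ u₁ u₂ (e : g₁ u₁ ≡ g₂ u₂) → f₁ (gap u₁ u₂ e) ≡ u₁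
    gap-f₂    : ∀ u₁ u₂ (e : g₁ u₁ ≡ g₂ u₂) → f₂ (gap u₁ u₂ e) ≡ u₂
    gap-unique : ∀ u v → f₁ u ≡ f₁ v → f₂ u ≡ f₂ v → u ≡ v

record Tripos (c ℓ₁ ℓ₂ : Level) : Setω where
  field
    P  : ∀ {a} → Set a → HeytingAlgebra (c ⊔ a) (ℓ₁ ⊔ a) (ℓ₂ ⊔ a)

  module H {a} (X : Set a) = HeytingAlgebra (P X)

  field
    Pf : ∀ {a b} {X : Set a} {Y : Set b} → (X → Y) → H.Carrier Y → H.Carrier X

    Pf-cong : ∀ {a b} {X : Set a} {Y : Set b} (f : X → Y) {φ ψ} →
              H._≈_ Y φ ψ → H._≈_ X (Pf f φ) (Pf f ψ)
    Pf-mono : ∀ {a b} {X : Set a} {Y : Set b} (f : X → Y) {φ ψ} →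
              H._≤_ Y φ ψ → H._≤_ X (Pf f φ) (Pf f ψ)
    Pf-∧ : ∀ {a b} {X : Set a} {Y : Set b} (f : X → Y) φ ψ →
           H._≈_ X (Pf f (H._∧_ Y φ ψ)) (H._∧_ X (Pf f φ) (Pf f ψ))
    Pf-∨ : ∀ {a b} {X : Set a} {Y : Set b} (f : X → Y) φ ψ →
           H._≈_ X (Pf f (H._∨_ Y φ ψ)) (H._∨_ X (Pf f φ) (Pf f ψ))
    Pf-⇨ : ∀ {a b} {X : Set a} {Y : Set b} (f : X → Y) φ ψ →
           H._≈_ X (Pf f (H._⇨_ Y φ ψ)) (H._⇨_ X (Pf f φ) (Pf f ψ))
    Pf-⊤ : ∀ {a b} {X : Set a} {Y : Set b} (f : X → Y) →
           H._≈_ X (Pf f (H.⊤ Y)) (H.⊤ X)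
    Pf-⊥ : ∀ {a b} {X : Set a} {Y : Set b} (f : X → Y) →
           H._≈_ X (Pf f (H.⊥ Y)) (H.⊥ X)

    -- functoriality (morphisms of Set are extensional functions)
    Pf-ext : ∀ {a b} {X : Set a} {Y : Set b} (f g : X → Y) →
             (∀ u → f u ≡ g u) → ∀ φ → H._≈_ X (Pf f φ) (Pf g φ)
    Pf-id  : ∀ {a} {X : Set a} φ → H._≈_ X (Pf (id {A = X}) φ) φ
    Pf-∘   : ∀ {a b d} {X : Set a} {Y : Set b} {Z : Set d} (f : X → Y) (g : Y → Z) φ →
             H._≈_ X (Pf (g ∘ f) φ) (Pf f (Pf g φ))

    ∃f : ∀ {a b} {X : Set a} {Y : Set b} → (X → Y) → H.Carrier X → H.Carrier Y
    ∀f : ∀ {a b} {X : Set a} {Y : Set b} → (X → Y) → H.Carrier X → H.Carrier Y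
    ∃f-mono : ∀ {a b} {X : Set a} {Y : Set b} (f : X → Y) {φ ψ} →
              H._≤_ X φ ψ → H._≤_ Y (∃f f φ) (∃f f ψ)
    ∀f-mono : ∀ {a b} {X : Set a} {Y : Set b} (f : X → Y) {φ ψ} →
              H._≤_ X φ ψ → H._≤_ Y (∀f f φ) (∀f f ψ)
    ∃f-unit   : ∀ {a b} {X : Set a} {Y : Set b} (f : X → Y) φ →
                H._≤_ X φ (Pf f (∃f f φ))
    ∃f-counit : ∀ {a b} {X : Set a} {Y : Set b} (f : X → Y) ψ →
                H._≤_ Y (∃f f (Pf f ψ)) ψ
    ∀f-unit   : ∀ {a b} {X : Set a} {Y : Set b} (f : X → Y) ψ →
                H._≤_ Y ψ (∀f f (Pf f ψ))
    ∀f-counit : ∀ {a b} {X : Set a} {Y : Set b} (f : X → Y) φ →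
                H._≤_ X (Pf f (∀f f φ)) φ

    BC-∃ : ∀ {x x₁ x₂ y} {X : Set x} {X₁ : Set x₁} {X₂ : Set x₂} {Y : Set y}
             (f₁ : X → X₁) (f₂ : X → X₂) (g₁ : X₁ → Y) (g₂ : X₂ → Y) →
             IsPullback f₁ f₂ g₁ g₂ →
             ∀ φ → H._≈_ X₁ (∃f f₁ (Pf f₂ φ)) (Pf g₁ (∃f g₂ φ))
    BC-∀ : ∀ {x x₁ x₂ y} {X : Set x} {X₁ : Set x₁} {X₂ : Set x₂} {Y : Set y}
             (f₁ : X → X₁) (f₂ : X → X₂) (g₁ : X₁ → Y) (g₂ : X₂ → Y) →
             IsPullback f₁ f₂ g₁ g₂ →
             ∀ φ → H._≈_ X₁ (∀f f₁ (Pf f₂ φ)) (Pf g₁ (∀f g₂ φ))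

    Sig  : Set
    tr   : H.Carrier Sig
    generic : ∀ {a} {X : Set a} (φ : H.Carrier X) →
              ∃ λ (σ : X → Sig) → H._≈_ X (Pf σ tr) φ

  ⟦_⟧ : ∀ {a} {X : Set a} → (X → Sig) → H.Carrier X
  ⟦ σ ⟧ = Pf σ tr

  𝔓 : (ℓ : Level) → Set (suc ℓ)
  𝔓 ℓ = Sig → Set ℓ

  _⊆_ : ∀ {ℓ ℓ'} → (Sig → Set ℓ) → (Sig → Set ℓ') → Set (ℓ ⊔ ℓ')
  s ⊆ s' = ∀ {ξ} → s ξ → s' ξ

  E : (ℓ : Level) → Set (suc ℓ)
  E ℓ = Σ (Sig × 𝔓 ℓ) (λ p → proj₂ p (proj₁ p))

  e₁ : ∀ {ℓ} → E ℓ → Sig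
  e₁ ((ξ , s) , _) = ξ

  e₂ : ∀ {ℓ} → E ℓ → 𝔓 ℓ
  e₂ ((ξ , s) , _) = s

  IsImp : (Sig × Sig → Sig) → Set ℓ₁
  IsImp imp = H._≈_ (Sig × Sig) ⟦ imp ⟧
                (H._⇨_ (Sig × Sig) ⟦ proj₁ ⟧ ⟦ proj₂ ⟧)

  IsMeet : (∀ {ℓ} → 𝔓 ℓ → Sig) → Setω
  IsMeet meet = ∀ ℓ → H._≈_ (𝔓 ℓ) ⟦ meet {ℓ} ⟧ (∀f (e₂ {ℓ}) ⟦ e₁ {ℓ} ⟧)

-- A meet ⋀̇ s' is a lower bound of s' ⊇ s, so it lies below ⋀̇ s; hence
-- (⋀̇ s) →̇ ξ ≤ (⋀̇ s') →̇ ξ, and every element of the left-hand family is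
-- implied by the element (⋀̇ s) →̇ ξ of the right-hand family.  Conversely
-- the right-hand family is the subfamily s' = s.  Both inequalities are
-- instances of the universal property of ⋀̇, which the tripos axioms give
-- through the adjunction P f ⊣ ∀f and Beck–Chevalley.
module Submission where

open import Defs
open import Level using (Level)
open import Data.Product using (Σ; _×_; _,_; proj₁; proj₂)
open import Function using (_∘_)
open import Relation.Binary.PropositionalEquality using (_≡_; refl; sym)
import Relation.Binary.Lattice.Properties.HeytingAlgebra as HeytingAlgebraProperties
import Relation.Binary.Reasoning.PartialOrder as PosetReasoning

module TriposLogic {c ℓ₁ ℓ₂ : Level} (T : Tripos c ℓ₁ ℓ₂) where
  open Tripos T public

  module ≤-Reasoning {a} (X : Set a) = PosetReasoning (H.poset X)
  module HP {a} (X : Set a) = HeytingAlgebraProperties (P X)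

  ⟦∘⟧ : ∀ {a b} {X : Set a} {Y : Set b} (σ : Y → Sig) (f : X → Y) →
        H._≈_ X ⟦ σ ∘ f ⟧ (Pf f ⟦ σ ⟧)
  ⟦∘⟧ σ f = Pf-∘ f σ tr

  Members : ∀ {a ℓ} {X : Set a} → (X → 𝔓 ℓ) → Set _
  Members {X = X} F = Σ X λ x → Σ Sig (F x)

  member : ∀ {a ℓ} {X : Set a} {F : X → 𝔓 ℓ} → Members F → Sig
  member (_ , ξ , _) = ξ

  asElement : ∀ {a ℓ} {X : Set a} (F : X → 𝔓 ℓ) → Members F → E ℓ
  asElement F (x , ξ , ξ∈Fx) = (ξ , F x) , ξ∈Fx

  Members-isPullback : ∀ {a ℓ} {X : Set a} (F : X → 𝔓 ℓ) →
                       IsPullback proj₁ (asElement F) F e₂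
  Members-isPullback F = record
    { commutes   = λ _ → refl
    ; gap        = gap
    ; gap-f₁     = gap-f₁
    ; gap-f₂     = gap-f₂
    ; gap-unique = gap-unique
    }
    where
    gap : ∀ x e → F x ≡ e₂ e → Members F
    gap x ((ξ , _) , ξ∈s) refl = x , ξ , ξ∈s
    gap-f₁ : ∀ x e (F≡ : F x ≡ e₂ e) → proj₁ (gap x e F≡) ≡ x
    gap-f₁ x ((ξ , _) , ξ∈s) refl = refl
    gap-f₂ : ∀ x e (F≡ : F x ≡ e₂ e) → asElement F (gap x e F≡) ≡ e
    gap-f₂ x ((ξ , _) , ξ∈s) refl = refl
    gap-unique : ∀ u v → proj₁ u ≡ proj₁ v → asElement F u ≡ asElement F v → u ≡ v
    gap-unique (x , ξ , ξ∈Fx) (.x , .ξ , .ξ∈Fx) refl refl = refl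

  ⟦imp⟧≈⇨ : (imp : Sig × Sig → Sig) → IsImp imp →
            ∀ {a} {X : Set a} (σ τ : X → Sig) →
            H._≈_ X ⟦ (λ x → imp (σ x , τ x)) ⟧ (H._⇨_ X ⟦ σ ⟧ ⟦ τ ⟧)
  ⟦imp⟧≈⇨ imp isImp {X = X} σ τ =
    H.Eq.trans X (⟦∘⟧ imp pair)
    (H.Eq.trans X (Pf-cong pair isImp)
    (H.Eq.trans X (Pf-⇨ pair _ _)
    (HP.⇨-cong X (H.Eq.sym X (⟦∘⟧ proj₁ pair)) (H.Eq.sym X (⟦∘⟧ proj₂ pair)))))
    where
    pair : X → Sig × Sig
    pair x = σ x , τ x

  module _ (meet : ∀ {ℓ} → 𝔓 ℓ → Sig) (isMeet : IsMeet meet) where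

    ⟦meet⟧≤ : ∀ {a ℓ} {X : Set a} (F : X → 𝔓 ℓ) (σ : X → Sig) →
              (∀ x → F x (σ x)) → H._≤_ X ⟦ meet ∘ F ⟧ ⟦ σ ⟧
    ⟦meet⟧≤ {ℓ = ℓ} {X = X} F σ σ∈F = begin
      ⟦ meet ∘ F ⟧                 ≈⟨ ⟦∘⟧ meet F ⟩
      Pf F ⟦ meet ⟧                ≈⟨ Pf-cong F (isMeet ℓ) ⟩
      Pf F (∀f e₂ ⟦ e₁ ⟧)          ≈⟨ Pf-∘ element e₂ _ ⟩
      Pf element (Pf e₂ (∀f e₂ ⟦ e₁ ⟧)) ≤⟨ Pf-mono element (∀f-counit e₂ ⟦ e₁ ⟧) ⟩
      Pf element ⟦ e₁ ⟧            ≈⟨ ⟦∘⟧ e₁ element ⟨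
      ⟦ σ ⟧                        ∎
      where
      open ≤-Reasoning X
      element : X → E ℓ
      element x = (σ x , F x) , σ∈F x

    ≤⟦meet⟧ : ∀ {a ℓ} {X : Set a} (F : X → 𝔓 ℓ) ψ →
              H._≤_ (Members F) (Pf proj₁ ψ) ⟦ member ⟧ →
              H._≤_ X ψ ⟦ meet ∘ F ⟧
    ≤⟦meet⟧ {ℓ = ℓ} {X = X} F ψ ψ≤member = begin
      ψ                                       ≤⟨ ∀f-unit proj₁ ψ ⟩
      ∀f proj₁ (Pf proj₁ ψ)                   ≤⟨ ∀f-mono proj₁ ψ≤member ⟩
      ∀f proj₁ ⟦ member ⟧                     ≤⟨ ∀f-mono proj₁ (H.reflexive (Members F) (⟦∘⟧ e₁ (asElement F))) ⟩
      ∀f proj₁ (Pf (asElement F) ⟦ e₁ ⟧)       ≈⟨ BC-∀ proj₁ (asElement F) F e₂ (Members-isPullback F) _ ⟩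
      Pf F (∀f e₂ ⟦ e₁ ⟧)                     ≈⟨ Pf-cong F (isMeet ℓ) ⟨
      Pf F ⟦ meet ⟧                           ≈⟨ ⟦∘⟧ meet F ⟨
      ⟦ meet ∘ F ⟧                            ∎
      where open ≤-Reasoning X

    ⟦meet⟧-antitone : ∀ {a ℓ ℓ'} {X : Set a} (F : X → 𝔓 ℓ) (G : X → 𝔓 ℓ') →
                      (∀ x → G x ⊆ F x) → H._≤_ X ⟦ meet ∘ F ⟧ ⟦ meet ∘ G ⟧
    ⟦meet⟧-antitone {X = X} F G G⊆F = ≤⟦meet⟧ G _ (begin
      Pf proj₁ ⟦ meet ∘ F ⟧     ≈⟨ ⟦∘⟧ (meet ∘ F) proj₁ ⟨
      ⟦ meet ∘ F ∘ proj₁ ⟧      ≤⟨ ⟦meet⟧≤ (F ∘ proj₁) member (λ { (x , _ , ξ∈Gx) → G⊆F x ξ∈Gx }) ⟩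
      ⟦ member ⟧                ∎)
      where open ≤-Reasoning (Members G)

lemma3p10 : ∀ {c ℓ₁ ℓ₂ : Level} (T : Tripos c ℓ₁ ℓ₂) →
    let open Tripos T in
    (imp : Sig × Sig → Sig) → IsImp imp →
    (meet : ∀ {ℓ} → 𝔓 ℓ → Sig) → IsMeet meet →
    H._≈_ (𝔓 Level.zero × 𝔓 Level.zero)
      ⟦ (λ { (s , t) → meet (λ ζ → Σ (𝔓 Level.zero) λ s' → Σ Sig λ ξ →
                                      (s ⊆ s') × t ξ × (ζ ≡ imp (meet s' , ξ))) }) ⟧
      ⟦ (λ { (s , t) → meet (λ ζ → Σ Sig λ ξ → t ξ × (ζ ≡ imp (meet s , ξ))) }) ⟧
lemma3p10 T imp isImp meet isMeet = H.antisym Pair (⟦meet⟧-antitone meet isMeet A B B⊆A) B≤A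
  where
  open TriposLogic T
  Pair : Set₁
  Pair = 𝔓 Level.zero × 𝔓 Level.zero

  A : Pair → 𝔓 (Level.suc Level.zero)
  A (s , t) ζ = Σ (𝔓 Level.zero) λ s' → Σ Sig λ ξ → (s ⊆ s') × t ξ × (ζ ≡ imp (meet s' , ξ))

  B : Pair → 𝔓 Level.zero
  B (s , t) ζ = Σ Sig λ ξ → t ξ × (ζ ≡ imp (meet s , ξ))

  B⊆A : ∀ x → B x ⊆ A x
  B⊆A (s , _) (ξ , ξ∈t , ζ≡) = s , ξ , (λ ξ∈s → ξ∈s) , ξ∈t , ζ≡

  B≤A : H._≤_ Pair ⟦ meet ∘ B ⟧ ⟦ meet ∘ A ⟧
  B≤A = ≤⟦meet⟧ meet isMeet A _ (begin
    Pf proj₁ ⟦ meet ∘ B ⟧                    ≈⟨ ⟦∘⟧ (meet ∘ B) proj₁ ⟨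
    ⟦ meet ∘ B ∘ proj₁ ⟧                     ≤⟨ ⟦meet⟧≤ meet isMeet (B ∘ proj₁) (λ q → imp (⋀s q , ξ q))
                                                    (λ { (_ , _ , _ , ξ , _ , ξ∈t , _) → ξ , ξ∈t , refl }) ⟩
    ⟦ (λ q → imp (⋀s q , ξ q)) ⟧             ≈⟨ ⟦imp⟧≈⇨ imp isImp ⋀s ξ ⟩
    H._⇨_ (Members A) ⟦ ⋀s ⟧ ⟦ ξ ⟧           ≤⟨ HP.⇨-relax (Members A) ⋀s'≤⋀s (H.refl (Members A)) ⟩
    H._⇨_ (Members A) ⟦ ⋀s' ⟧ ⟦ ξ ⟧          ≈⟨ ⟦imp⟧≈⇨ imp isImp ⋀s' ξ ⟨
    ⟦ (λ q → imp (⋀s' q , ξ q)) ⟧            ≈⟨ Pf-ext _ _ (λ { (_ , _ , _ , _ , _ , _ , ζ≡) → sym ζ≡ }) tr ⟩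
    ⟦ member ⟧                               ∎)
    where
    open ≤-Reasoning (Members A)
    ⋀s ⋀s' ξ : Members A → Sig
    ⋀s ((s , _) , _) = meet s
    ⋀s' (_ , _ , s' , _) = meet s'
    ξ (_ , _ , _ , ξ , _) = ξ

    ⋀s'≤⋀s : H._≤_ (Members A) ⟦ ⋀s' ⟧ ⟦ ⋀s ⟧
    ⋀s'≤⋀s = ⟦meet⟧-antitone meet isMeet (λ { (_ , _ , s' , _) → s' }) (λ { ((s , _) , _) → s })
               (λ { (_ , _ , _ , _ , s⊆s' , _) → s⊆s' })
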